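{- The generating functions $F_{ab}(x,u,q)$, $a,b\in\{0,1\}$, satisfy \[ \begin{aligned} F_{00}(x,u,q)&=\frac{xu^2q}{qu^2-1}\left(F_{10}(x,\sqrt{q}u,q)-F_{10}(x,1,q) +\sqrt{q}uF_{11}(x,\sqrt{q}u,q)-F_{11}(x,1,q)\right),\\ F_{10}(x,u,q)&=\frac{xu^2q}{qu^2-1}\left(F_{00}(x,\sqrt{q}u,q)-F_{00}(x,1,q)+\sqrt{q}uF_{01}(x,\sqrt{q}u,q)-F_{01}(x,1,q)\right),\\ F_{01}(x,u,q)&=\frac{xu}{qu^2-1}\left(u^2qF_{10}(x,\sqrt{q}u,q)-F_{10}(x,1,q)+\sqrt{q}uF_{11}(x,\sqrt{q}u,q)-F_{11}(x,1,q)\right),\\ F_{11}(x,u,q)&=xuq+\frac{xuq}{qu^2-1}\left(u^2qF_{00}(x,\sqrt{q}u,q)-F_{00}(x,1,q)\right)+\frac{xuq}{qu^2-1}\left(\sqrt{q}uF_{01}(x,\sqrt{q}u,q)-F_{01}(x,1,q)\right). \end{aligned} \]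
   Context: A Catalan word of length $n\geq1$ is a sequence $w_1\cdots w_n$ of nonnegative integers with $w_1=0$ and $w_i\leq w_{i-1}+1$ for $2\le i\le n$; its Catalan polyomino is the bargraph whose $i$th column has $w_i+1$ cells, columns bottom-aligned. $\mathbf{C}$ is the set of all Catalan polyominoes (with at least one column). For $P\in\mathbf{C}$: $\mathrm{lth}(P)$ is the number of columns, $\mathrm{last}(P)$ is the number of cells of the last column, and $\mathrm{bck}(P)$ is the number of black cells when the cells are colored in a chessboard pattern with the southwestern cell black (the cell in column $j$ and row $r$, both indexed from 1, is black iff $j+r$ is even). For $a,b\in\{0,1\}$, $F_{ab}(x,u,q)=\sum x^{\mathrm{lth}(P)}u^{\mathrm{last}(P)}q^{\mathrm{bck}(P)}$, the sum over all $P\in\mathbf{C}$ with $\mathrm{lth}(P)\equiv a \pmod 2$ and $\mathrm{last}(P)\equiv b\pmod 2$. Expressions such as $F_{ab}(x,\sqrt q u,q)$ denote substitution of $\sqrt q\,u$ for $u$. -}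

module Defs where

open import Level using (0ℓ)
open import Algebra.Bundles using (CommutativeRing)
open import Data.Nat using (ℕ; zero; suc; _%_; _≡ᵇ_) renaming (_+_ to _+ℕ_)
open import Data.Bool using (Bool; true; false; if_then_else_; _∧_)
open import Data.List using (List; []; _∷_; [_]; _++_; map; concatMap; upTo; length; filter; foldr)
open import Relation.Nullary.Decidable using (Dec; yes; no)
open import Relation.Binary.PropositionalEquality using (_≡_; refl)
open import Data.Bool.Properties using (_≟_)

-- last entry of a (nonempty) word; 0 on the empty list (never used there)
lastOr : List ℕ → ℕ
lastOr []           = 0
lastOr (x ∷ [])     = x
lastOr (x ∷ y ∷ ws) = lastOr (y ∷ ws)

-- All Catalan words w₁⋯wₙ of length n (listed in natural order w₁ first):
-- w₁ = 0 and w_{i} ≤ w_{i-1} + 1.  There are none of length 0.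
catalanWords : ℕ → List (List ℕ)
catalanWords zero          = []
catalanWords (suc zero)    = [ 0 ∷ [] ]
catalanWords (suc (suc n)) =
  concatMap (λ w → map (λ k → w ++ [ k ]) (upTo (suc (suc (lastOr w)))))
            (catalanWords (suc n))

lth : List ℕ → ℕ
lth = length

-- number of cells of the last column = w_n + 1
lastCol : List ℕ → ℕ
lastCol w = suc (lastOr w)

isEven : ℕ → Bool
isEven zero          = true
isEven (suc zero)    = false
isEven (suc (suc n)) = isEven n

-- number of black cells (j + r even) among rows r = 1..h of column j
blacksInCol : ℕ → ℕ → ℕ
blacksInCol j zero    = 0
blacksInCol j (suc h) = blacksInCol j h +ℕ (if isEven (j +ℕ suc h) then 1 else 0)

-- black cells of the columns starting at column index j (1-based)
bckFrom : ℕ → List ℕ → ℕ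
bckFrom j []       = 0
bckFrom j (h ∷ ws) = blacksInCol j (suc h) +ℕ bckFrom (suc j) ws

bck : List ℕ → ℕ
bck = bckFrom 1

parityIs : ℕ → ℕ → Bool
parityIs a n = (n % 2) ≡ᵇ a

module GF (R : CommutativeRing 0ℓ 0ℓ) where
  open CommutativeRing R

  -- formal power series in x over R, as coefficient sequences
  Series : Set
  Series = ℕ → Carrier

  pow : Carrier → ℕ → Carrier
  pow c zero    = 1#
  pow c (suc n) = c * pow c n

  ∑ : List Carrier → Carrier
  ∑ = foldr _+_ 0#

  -- F_ab(x,u,q) : coefficient of x^n is the sum over Catalan polyominoes
  -- of length n with lth ≡ a, last ≡ b (mod 2) of u^last q^bck
  F : ℕ → ℕ → Carrier → Carrier → Series
  F a b u q n =
    ∑ (map (λ w → pow u (lastCol w) * pow q (bck w))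
           (filter (λ w → (parityIs a (lth w) ∧ parityIs b (lastCol w)) ≟ true)
                   (catalanWords n)))

  infixl 6 _⊕_ _⊖_
  infixl 7 _⊙_

  _⊕_ : Series → Series → Series
  (f ⊕ g) n = f n + g n

  _⊖_ : Series → Series → Series
  (f ⊖ g) n = f n - g n

  _⊙_ : Carrier → Series → Series
  (c ⊙ f) n = c * f n

  X : Series → Series
  X f zero    = 0#
  X f (suc n) = f n

  monoX : Carrier → Series
  monoX c zero          = 0#
  monoX c (suc zero)    = c
  monoX c (suc (suc n)) = 0#

  _≈ₛ_ : Series → Series → Set
  f ≈ₛ g = ∀ n → f n ≈ g n

{-# OPTIONS --safe #-}
-- A Catalan word of length n + 2 is uniquely w k with w of length n + 1 and k ≤ lastOr w + 1, so the
-- coefficient of xⁿ⁺² sums, over w, the weight of w times the weights of the possible appended columns.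
-- The number of black cells of such a column depends only on its height and on the parity of its
-- position, and two extra cells always contain exactly one black cell, so for heights of a fixed parity
-- these weights form a geometric progression with ratio q u² = t², t = √q u.  Multiplied by t² − 1 the
-- sum telescopes to its boundary terms: the lower one is a constant, the upper one a constant times t^L
-- or t^(L+1) according to the parity of L = last(w), and these are the weights of w in F_{a′0} and
-- F_{a′1} at u = 1 and u = t.  The coefficients of x⁰ and x¹ are checked directly.
module Submission where

open import Defs
open import Level using (0ℓ)
open import Algebra.Bundles using (CommutativeRing)
open import Data.Bool using (Bool; true; false; T; _∧_; if_then_else_)
open import Data.Bool.Properties using (_≟_)
open import Data.Product using (_×_; _,_)
open import Data.Nat as ℕ using (ℕ; zero; suc; _%_; _≡ᵇ_) renaming (_+_ to _+ℕ_)
import Data.Nat.Properties as ℕₚ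
open import Data.Nat.DivMod using (%-remove-+ˡ)
open import Data.Nat.Divisibility using (∣-refl)
open import Data.Integer using (0ℤ; 1ℤ)
open import Data.List using (List; []; _∷_; _++_; _∷ʳ_; map; concatMap; filter; length; upTo; applyUpTo)
open import Data.List.Properties using (length-++-comm; map-++; map-∘; map-upTo)
open import Data.List.Relation.Unary.All as All using (All; []; _∷_)
open import Data.List.Relation.Unary.All.Properties using (concat⁺; map⁺)
open import Function using (_∘_)
open import Relation.Binary.PropositionalEquality as ≡ using (_≡_)

-- Algebra.Solver.Ring must decide equality of coefficients for x − x to normalise to 0, so it is
-- instantiated with ℤ through the canonical homomorphism ℤ → R.
module IntegerCoefficients (R : CommutativeRing 0ℓ 0ℓ) where
  open CommutativeRing R
  open import Data.Integer as ℤ using (ℤ; +_; -[1+_]; sign; ∣_∣; _◃_; _⊖_)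
  open import Data.Integer.Properties using ([1+m]⊖[1+n]≡m⊖n; ◃-inverse)
  open import Data.Sign as Sign using (Sign)
  open import Data.Maybe using (Maybe; just; nothing)
  open import Relation.Nullary using (yes; no)
  import Algebra.Solver.Ring.AlmostCommutativeRing as ACR
  open import Algebra.Properties.Ring ring using (-1*x≈-x)
  open import Algebra.Properties.Group +-group using (ε⁻¹≈ε; ⁻¹-involutive)
  open import Algebra.Properties.AbelianGroup +-abelianGroup using (⁻¹-∙-comm; xyx⁻¹≈y)
  open import Algebra.Properties.CommutativeSemigroup *-commutativeSemigroup using (interchange)
  open import Algebra.Properties.Semiring.Mult.TCOptimised semiring 
    using (1+×; ×-homo-+; ×1-homo-*) renaming (_×_ to _×′_)
  open import Relation.Binary.Reasoning.Setoid setoid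

  ι : ℕ → Carrier
  ι n = n ×′ 1#

  ⟦_⟧ : ℤ → Carrier
  ⟦ + n ⟧      = ι n
  ⟦ -[1+ n ] ⟧ = - ι (suc n)

  σ : Sign → Carrier
  σ Sign.+ = 1#
  σ Sign.- = - 1#

  ⊖-homo : ∀ m n → ⟦ m ⊖ n ⟧ ≈ ι m - ι n
  ⊖-homo zero    zero    = sym (-‿inverseʳ 0#)
  ⊖-homo zero    (suc n) = sym (+-identityˡ _)
  ⊖-homo (suc m) zero    = sym (trans (+-congˡ ε⁻¹≈ε) (+-identityʳ _))
  ⊖-homo (suc m) (suc n) = begin
    ⟦ suc m ⊖ suc n ⟧          ≡⟨ ≡.cong ⟦_⟧ ([1+m]⊖[1+n]≡m⊖n m n) ⟩
    ⟦ m ⊖ n ⟧                  ≈⟨ ⊖-homo m n ⟩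
    ι m - ι n                  ≈⟨ +-congʳ (xyx⁻¹≈y 1# (ι m)) ⟨
    1# + ι m - 1# - ι n        ≈⟨ +-assoc _ _ _ ⟩
    1# + ι m + (- 1# - ι n)    ≈⟨ +-congˡ (⁻¹-∙-comm 1# (ι n)) ⟩
    1# + ι m - (1# + ι n)      ≈⟨ +-cong (1+× m 1#) (-‿cong (1+× n 1#)) ⟨
    ι (suc m) - ι (suc n)      ∎

  +-homo : ∀ i j → ⟦ i ℤ.+ j ⟧ ≈ ⟦ i ⟧ + ⟦ j ⟧
  +-homo -[1+ m ] -[1+ n ] = begin
    - ι (suc (suc (m ℕ.+ n)))  ≡⟨ ≡.cong (λ k → - ι (suc k)) (ℕₚ.+-suc m n) ⟨
    - ι (suc m ℕ.+ suc n)      ≈⟨ -‿cong (×-homo-+ 1# (suc m) (suc n)) ⟩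
    - (ι (suc m) + ι (suc n))  ≈⟨ ⁻¹-∙-comm _ _ ⟨
    - ι (suc m) - ι (suc n)    ∎
  +-homo -[1+ m ] (+ n)    = trans (⊖-homo n (suc m)) (+-comm _ _)
  +-homo (+ m)    -[1+ n ] = ⊖-homo m (suc n)
  +-homo (+ m)    (+ n)    = ×-homo-+ 1# m n

  ◃-homo : ∀ s n → ⟦ s ◃ n ⟧ ≈ σ s * ι n
  ◃-homo s      zero    = sym (zeroʳ _)
  ◃-homo Sign.+ (suc n) = sym (*-identityˡ _)
  ◃-homo Sign.- (suc n) = sym (-1*x≈-x _)

  σ-homo : ∀ s t → σ (s Sign.* t) ≈ σ s * σ t
  σ-homo Sign.+ t      = sym (*-identityˡ _)
  σ-homo Sign.- Sign.+ = sym (*-identityʳ _)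
  σ-homo Sign.- Sign.- = sym (trans (-1*x≈-x (- 1#)) (⁻¹-involutive 1#))

  *-homo : ∀ i j → ⟦ i ℤ.* j ⟧ ≈ ⟦ i ⟧ * ⟦ j ⟧
  *-homo i j = begin
    ⟦ sign i Sign.* sign j ◃ ∣ i ∣ ℕ.* ∣ j ∣ ⟧
      ≈⟨ ◃-homo (sign i Sign.* sign j) (∣ i ∣ ℕ.* ∣ j ∣) ⟩
    σ (sign i Sign.* sign j) * ι (∣ i ∣ ℕ.* ∣ j ∣)
      ≈⟨ *-cong (σ-homo (sign i) (sign j)) (×1-homo-* ∣ i ∣ ∣ j ∣) ⟩
    σ (sign i) * σ (sign j) * (ι ∣ i ∣ * ι ∣ j ∣)    ≈⟨ interchange _ _ _ _ ⟩
    σ (sign i) * ι ∣ i ∣ * (σ (sign j) * ι ∣ j ∣)    ≈⟨ *-cong (sign-abs i) (sign-abs j) ⟨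
    ⟦ i ⟧ * ⟦ j ⟧                                    ∎
    where
    sign-abs : ∀ k → ⟦ k ⟧ ≈ σ (sign k) * ι ∣ k ∣
    sign-abs k = trans (reflexive (≡.cong ⟦_⟧ (≡.sym (◃-inverse k)))) (◃-homo (sign k) ∣ k ∣)

  -‿homo : ∀ i → ⟦ ℤ.- i ⟧ ≈ - ⟦ i ⟧
  -‿homo -[1+ n ]    = sym (⁻¹-involutive _)
  -‿homo (+ zero)    = sym ε⁻¹≈ε
  -‿homo (+ (suc n)) = refl

  almostCommutativeRing : ACR.AlmostCommutativeRing 0ℓ 0ℓ
  almostCommutativeRing = ACR.fromCommutativeRing R

  ℤ⟶R : ℤ.+-*-rawRing ACR.-Raw-AlmostCommutative⟶ almostCommutativeRing
  ℤ⟶R = record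
    { ⟦_⟧ = ⟦_⟧ ; +-homo = +-homo ; *-homo = *-homo ; -‿homo = -‿homo
    ; 0-homo = refl ; 1-homo = refl }

  _coeff≟_ : ∀ i j → Maybe (⟦ i ⟧ ≈ ⟦ j ⟧)
  i coeff≟ j with i ℤ.≟ j
  ... | yes ≡.refl = just refl
  ... | no _       = nothing

  open import Algebra.Solver.Ring ℤ.+-*-rawRing almostCommutativeRing ℤ⟶R _coeff≟_ public
    using (solve; _:=_; _:+_; _:*_; _:-_; con)

[2+n]%2≡n%2 : ∀ n → suc (suc n) % 2 ≡ n % 2
[2+n]%2≡n%2 n = %-remove-+ˡ {2} n {2} ∣-refl

parityIs-+2 : ∀ a n → parityIs a (suc (suc n)) ≡ parityIs a n
parityIs-+2 a n = ≡.cong (_≡ᵇ a) ([2+n]%2≡n%2 n)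

parityIs-0-suc : ∀ n → parityIs 0 (suc n) ≡ parityIs 1 n
parityIs-1-suc : ∀ n → parityIs 1 (suc n) ≡ parityIs 0 n

parityIs-0-suc zero          = ≡.refl
parityIs-0-suc (suc zero)    = ≡.refl
parityIs-0-suc (suc (suc n)) =
  ≡.trans (parityIs-+2 0 (suc n)) (≡.trans (parityIs-0-suc n) (≡.sym (parityIs-+2 1 n)))

parityIs-1-suc zero          = ≡.refl
parityIs-1-suc (suc zero)    = ≡.refl
parityIs-1-suc (suc (suc n)) =
  ≡.trans (parityIs-+2 1 (suc n)) (≡.trans (parityIs-1-suc n) (≡.sym (parityIs-+2 0 n)))

blacksInCol-+2 : ∀ j m → blacksInCol (suc (suc j)) m ≡ blacksInCol j m
blacksInCol-+2 j zero    = ≡.refl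
blacksInCol-+2 j (suc m) = ≡.cong (_+ℕ (if isEven (j +ℕ suc m) then 1 else 0)) (blacksInCol-+2 j m)

blacksInCol-%2 : ∀ j m → blacksInCol j m ≡ blacksInCol (j % 2) m
blacksInCol-%2 zero          m = ≡.refl
blacksInCol-%2 (suc zero)    m = ≡.refl
blacksInCol-%2 (suc (suc j)) m = ≡.trans (blacksInCol-+2 j m) (≡.trans (blacksInCol-%2 j m)
  (≡.cong (λ i → blacksInCol i m) (≡.sym ([2+n]%2≡n%2 j))))

blacksInCol-parity : ∀ {a j} → parityIs a j ≡ true → ∀ m → blacksInCol j m ≡ blacksInCol a m
blacksInCol-parity {a} {j} j≡a m = ≡.trans (blacksInCol-%2 j m)
  (≡.cong (λ i → blacksInCol i m) (ℕₚ.≡ᵇ⇒≡ (j % 2) a (≡.subst T (≡.sym j≡a) _)))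

isEven-one-of-two : ∀ x → (if isEven x then 1 else 0) +ℕ (if isEven (suc x) then 1 else 0) ≡ 1
isEven-one-of-two zero          = ≡.refl
isEven-one-of-two (suc zero)    = ≡.refl
isEven-one-of-two (suc (suc x)) = isEven-one-of-two x

blacksInCol-suc-suc : ∀ j m → blacksInCol j (suc (suc m)) ≡ suc (blacksInCol j m)
blacksInCol-suc-suc j m rewrite ℕₚ.+-suc j (suc m) =
  ≡.trans (ℕₚ.+-assoc (blacksInCol j m) _ _)
          (≡.trans (≡.cong (blacksInCol j m +ℕ_) (isEven-one-of-two (j +ℕ suc m))) (ℕₚ.+-comm _ 1))

lastOr-∷ʳ : ∀ w k → lastOr (w ∷ʳ k) ≡ k
lastOr-∷ʳ []           k = ≡.refl
lastOr-∷ʳ (x ∷ [])     k = ≡.refl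
lastOr-∷ʳ (x ∷ y ∷ w) k = lastOr-∷ʳ (y ∷ w) k

bckFrom-∷ʳ : ∀ j w k → bckFrom j (w ∷ʳ k) ≡ bckFrom j w +ℕ blacksInCol (j +ℕ length w) (suc k)
bckFrom-∷ʳ j []      k =
  ≡.trans (ℕₚ.+-identityʳ _) (≡.cong (λ i → blacksInCol i (suc k)) (≡.sym (ℕₚ.+-identityʳ j)))
bckFrom-∷ʳ j (h ∷ w) k = begin
  blacksInCol j (suc h) +ℕ bckFrom (suc j) (w ∷ʳ k)
    ≡⟨ ≡.cong (blacksInCol j (suc h) +ℕ_) (bckFrom-∷ʳ (suc j) w k) ⟩
  blacksInCol j (suc h) +ℕ (bckFrom (suc j) w +ℕ blacksInCol (suc j +ℕ length w) (suc k))
    ≡⟨ ℕₚ.+-assoc (blacksInCol j (suc h)) _ _ ⟨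
  blacksInCol j (suc h) +ℕ bckFrom (suc j) w +ℕ blacksInCol (suc j +ℕ length w) (suc k)
    ≡⟨ ≡.cong (λ i → blacksInCol j (suc h) +ℕ bckFrom (suc j) w +ℕ blacksInCol i (suc k))
              (ℕₚ.+-suc j (length w)) ⟨
  blacksInCol j (suc h) +ℕ bckFrom (suc j) w +ℕ blacksInCol (j +ℕ suc (length w)) (suc k) ∎
  where open ≡.≡-Reasoning

bck-∷ʳ : ∀ {a n} w k → length w ≡ suc n → parityIs a (suc (suc n)) ≡ true →
         bck (w ∷ʳ k) ≡ bck w +ℕ blacksInCol a (suc k)
bck-∷ʳ w k len j≡a = ≡.trans (bckFrom-∷ʳ 1 w k)
  (≡.cong (bck w +ℕ_) (≡.trans (≡.cong (λ i → blacksInCol (suc i) (suc k)) len)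
                               (blacksInCol-parity j≡a (suc k))))

catalanWords-length : ∀ n → All (λ w → length w ≡ n) (catalanWords n)
catalanWords-length zero          = []
catalanWords-length (suc zero)    = ≡.refl ∷ []
catalanWords-length (suc (suc n)) = concat⁺ (map⁺ (All.map extensions (catalanWords-length (suc n))))
  where
  extensions : ∀ {w} → length w ≡ suc n →
               All (λ v → length v ≡ suc (suc n)) (map (w ∷ʳ_) (upTo (suc (suc (lastOr w)))))
  extensions {w} len = map⁺ (All.universal (λ k → ≡.trans (length-++-comm w (k ∷ [])) (≡.cong suc len))
                                           (upTo (suc (suc (lastOr w)))))

module Sums (R : CommutativeRing 0ℓ 0ℓ) where
  open CommutativeRing R
  open GF R using (∑; pow)
  open IntegerCoefficients R using (solve; _:=_; _:+_; _:*_; _:-_; con)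
  open import Relation.Binary.Reasoning.Setoid setoid

  𝟙[_] : Bool → Carrier
  𝟙[ true ]  = 1#
  𝟙[ false ] = 0#

  𝟙-∧ : ∀ x y → 𝟙[ x ∧ y ] ≈ 𝟙[ x ] * 𝟙[ y ]
  𝟙-∧ true  y = sym (*-identityˡ _)
  𝟙-∧ false y = sym (zeroˡ _)

  𝟙-guard : ∀ b {x y} → (b ≡ true → x ≈ y) → 𝟙[ b ] * x ≈ 𝟙[ b ] * y
  𝟙-guard true  x≈y = *-congˡ (x≈y ≡.refl)
  𝟙-guard false x≈y = trans (zeroˡ _) (sym (zeroˡ _))

  𝟙-parity : ∀ n → 𝟙[ parityIs 0 n ] + 𝟙[ parityIs 1 n ] ≈ 1#
  𝟙-parity zero          = +-identityʳ 1#
  𝟙-parity (suc zero)    = +-identityˡ 1#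
  𝟙-parity (suc (suc n)) rewrite parityIs-+2 0 n | parityIs-+2 1 n = 𝟙-parity n

  pow-+ : ∀ x m n → pow x (m +ℕ n) ≈ pow x m * pow x n
  pow-+ x zero    n = sym (*-identityˡ _)
  pow-+ x (suc m) n = trans (*-congˡ (pow-+ x m n)) (sym (*-assoc _ _ _))

  pow-1# : ∀ n → pow 1# n ≈ 1#
  pow-1# zero    = refl
  pow-1# (suc n) = trans (*-identityˡ _) (pow-1# n)

  ∑-++ : ∀ xs ys → ∑ (xs ++ ys) ≈ ∑ xs + ∑ ys
  ∑-++ []       ys = sym (+-identityˡ _)
  ∑-++ (x ∷ xs) ys = trans (+-congˡ (∑-++ xs ys)) (sym (+-assoc _ _ _))

  module _ {I J : Set} where

    ∑-map-concatMap : ∀ (f : J → Carrier) (g : I → List J) xs →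
                      ∑ (map f (concatMap g xs)) ≈ ∑ (map (λ x → ∑ (map f (g x))) xs)
    ∑-map-concatMap f g []       = refl
    ∑-map-concatMap f g (x ∷ xs) = begin
      ∑ (map f (g x ++ concatMap g xs))              ≡⟨ ≡.cong ∑ (map-++ f (g x) (concatMap g xs)) ⟩
      ∑ (map f (g x) ++ map f (concatMap g xs))      ≈⟨ ∑-++ (map f (g x)) (map f (concatMap g xs)) ⟩
      ∑ (map f (g x)) + ∑ (map f (concatMap g xs))   ≈⟨ +-congˡ (∑-map-concatMap f g xs) ⟩
      ∑ (map f (g x)) + ∑ (map (λ x → ∑ (map f (g x))) xs) ∎

  module _ {I : Set} where

    ∑-map-congᴬ : ∀ {P : I → Set} {f g : I → Carrier} → (∀ {x} → P x → f x ≈ g x) →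
                  ∀ {xs} → All P xs → ∑ (map f xs) ≈ ∑ (map g xs)
    ∑-map-congᴬ f≈g []         = refl
    ∑-map-congᴬ f≈g (px ∷ pxs) = +-cong (f≈g px) (∑-map-congᴬ f≈g pxs)

    ∑-map-cong : ∀ {f g : I → Carrier} → (∀ x → f x ≈ g x) → ∀ xs → ∑ (map f xs) ≈ ∑ (map g xs)
    ∑-map-cong f≈g []       = refl
    ∑-map-cong f≈g (x ∷ xs) = +-cong (f≈g x) (∑-map-cong f≈g xs)

    ∑-map-*ˡ : ∀ c (f : I → Carrier) xs → ∑ (map (λ x → c * f x) xs) ≈ c * ∑ (map f xs)
    ∑-map-*ˡ c f []       = sym (zeroʳ c)
    ∑-map-*ˡ c f (x ∷ xs) = trans (+-congˡ (∑-map-*ˡ c f xs)) (sym (distribˡ c _ _))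

    ∑-map-filter : ∀ (P : I → Bool) (f : I → Carrier) xs →
                   ∑ (map f (filter (λ x → P x ≟ true) xs)) ≈ ∑ (map (λ x → 𝟙[ P x ] * f x) xs)
    ∑-map-filter P f []       = refl
    ∑-map-filter P f (x ∷ xs) with P x
    ... | true  = +-cong (sym (*-identityˡ _)) (∑-map-filter P f xs)
    ... | false = trans (∑-map-filter P f xs) (sym (trans (+-congʳ (zeroˡ _)) (+-identityˡ _)))

  ∑-telescope : ∀ r (g : ℕ → Carrier) → (∀ k → g (suc (suc k)) ≈ r * g k) →
                ∀ N → (r - 1#) * ∑ (map g (upTo N)) ≈ g N + g (suc N) - (g 0 + g 1)
  ∑-telescope r g g-rec N = trans (reflexive (≡.cong (λ xs → (r - 1#) * ∑ xs) (map-upTo g N))) (go g g-rec N)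
    where
    shift : ∀ r g₀ g₁ x → (r - 1#) * g₀ + (x - (g₁ + r * g₀)) ≈ x - (g₀ + g₁)
    shift = solve 4 (λ r g₀ g₁ x → (r :- con 1ℤ) :* g₀ :+ (x :- (g₁ :+ r :* g₀)) := x :- (g₀ :+ g₁)) refl

    go : ∀ g → (∀ k → g (suc (suc k)) ≈ r * g k) →
         ∀ N → (r - 1#) * ∑ (applyUpTo g N) ≈ g N + g (suc N) - (g 0 + g 1)
    go g g-rec zero    = trans (zeroʳ _) (sym (-‿inverseʳ _))
    go g g-rec (suc N) = begin
      (r - 1#) * (g 0 + ∑ (applyUpTo (g ∘ suc) N))
        ≈⟨ distribˡ _ _ _ ⟩
      (r - 1#) * g 0 + (r - 1#) * ∑ (applyUpTo (g ∘ suc) N)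
        ≈⟨ +-congˡ (go (g ∘ suc) (g-rec ∘ suc) N) ⟩
      (r - 1#) * g 0 + (g (suc N) + g (suc (suc N)) - (g 1 + g 2))
        ≈⟨ +-congˡ (+-congˡ (-‿cong (+-congˡ (g-rec 0)))) ⟩
      (r - 1#) * g 0 + (g (suc N) + g (suc (suc N)) - (g 1 + r * g 0))
        ≈⟨ shift r (g 0) (g 1) _ ⟩
      g (suc N) + g (suc (suc N)) - (g 0 + g 1) ∎

  adjacent-terms-by-parity : ∀ t (g : ℕ → Carrier) → (∀ k → g (suc (suc k)) ≈ t * t * g k) → ∀ L →
    g (suc L) + g (suc (suc L)) ≈
      𝟙[ parityIs 0 L ] * ((g 1 + g 2) * pow t L) + 𝟙[ parityIs 1 L ] * ((g 0 + g 1) * (t * pow t L))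
  adjacent-terms-by-parity t g g-rec zero = solve 4
    (λ g₀ g₁ g₂ t → g₁ :+ g₂ := con 1ℤ :* ((g₁ :+ g₂) :* con 1ℤ) :+ con 0ℤ :* ((g₀ :+ g₁) :* (t :* con 1ℤ)))
    refl (g 0) (g 1) (g 2) t
  adjacent-terms-by-parity t g g-rec (suc zero) = trans (+-cong (g-rec 0) (g-rec 1)) (solve 4
    (λ g₀ g₁ g₂ t → t :* t :* g₀ :+ t :* t :* g₁
                 := con 0ℤ :* ((g₁ :+ g₂) :* (t :* con 1ℤ)) :+ con 1ℤ :* ((g₀ :+ g₁) :* (t :* (t :* con 1ℤ))))
    refl (g 0) (g 1) (g 2) t)
  adjacent-terms-by-parity t g g-rec (suc (suc L)) = begin
    g (3 +ℕ L) + g (4 +ℕ L)                   ≈⟨ +-cong (g-rec (suc L)) (g-rec (suc (suc L))) ⟩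
    t * t * g (suc L) + t * t * g (2 +ℕ L)    ≈⟨ distribˡ (t * t) _ _ ⟨
    t * t * (g (suc L) + g (2 +ℕ L))          ≈⟨ *-congˡ (adjacent-terms-by-parity t g g-rec L) ⟩
    t * t * (e₀ * (x₀ * τ) + e₁ * (x₁ * (t * τ)))
      ≈⟨ solve 6 (λ t τ e₀ e₁ x₀ x₁ → t :* t :* (e₀ :* (x₀ :* τ) :+ e₁ :* (x₁ :* (t :* τ)))
                  := e₀ :* (x₀ :* (t :* (t :* τ))) :+ e₁ :* (x₁ :* (t :* (t :* (t :* τ)))))
                 refl t τ e₀ e₁ x₀ x₁ ⟩
    e₀ * (x₀ * pow t (2 +ℕ L)) + e₁ * (x₁ * (t * pow t (2 +ℕ L)))
      ≡⟨ ≡.cong₂ (λ p₀ p₁ → 𝟙[ p₀ ] * (x₀ * pow t (2 +ℕ L)) + 𝟙[ p₁ ] * (x₁ * (t * pow t (2 +ℕ L))))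
                 (parityIs-+2 0 L) (parityIs-+2 1 L) ⟨
    𝟙[ parityIs 0 (2 +ℕ L) ] * (x₀ * pow t (2 +ℕ L)) + 𝟙[ parityIs 1 (2 +ℕ L) ] * (x₁ * (t * pow t (2 +ℕ L)))
      ∎
    where
    τ e₀ e₁ x₀ x₁ : Carrier
    τ  = pow t L
    e₀ = 𝟙[ parityIs 0 L ]
    e₁ = 𝟙[ parityIs 1 L ]
    x₀ = g 1 + g 2
    x₁ = g 0 + g 1

module Recurrence (R : CommutativeRing 0ℓ 0ℓ) (u s d : CommutativeRing.Carrier R) where
  open CommutativeRing R
  open GF R
  open Sums R
  open IntegerCoefficients R using (solve; _:=_; _:+_; _:*_; _:-_; con)
  open import Relation.Binary.Reasoning.Setoid setoid

  q t : Carrier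
  q = s * s
  t = s * u

  weight : ℕ → Carrier → ℕ → ℕ → Carrier
  weight b v L β = 𝟙[ parityIs b L ] * (pow v L * pow q β)

  -- Φ b v n is the coefficient of xⁿ in F₀ᵦ + F₁ᵦ, i.e. with no condition on the parity of lth.
  Φ : ℕ → Carrier → ℕ → Carrier
  Φ b v n = ∑ (map (λ w → weight b v (lastCol w) (bck w)) (catalanWords n))

  F≈𝟙*Φ : ∀ a b v n → F a b v q n ≈ 𝟙[ parityIs a n ] * Φ b v n
  F≈𝟙*Φ a b v n = begin
    F a b v q n
      ≈⟨ ∑-map-filter (λ w → parityIs a (lth w) ∧ parityIs b (lastCol w))
                      (λ w → pow v (lastCol w) * pow q (bck w)) ws ⟩
    ∑ (map (λ w → 𝟙[ parityIs a (lth w) ∧ parityIs b (lastCol w) ] * (pow v (lastCol w) * pow q (bck w))) ws)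
      ≈⟨ ∑-map-congᴬ (λ {w} → split {w}) (catalanWords-length n) ⟩
    ∑ (map (λ w → 𝟙[ parityIs a n ] * weight b v (lastCol w) (bck w)) ws)
      ≈⟨ ∑-map-*ˡ 𝟙[ parityIs a n ] (λ w → weight b v (lastCol w) (bck w)) ws ⟩
    𝟙[ parityIs a n ] * Φ b v n ∎
    where
    ws : List (List ℕ)
    ws = catalanWords n

    split : ∀ {w} → length w ≡ n →
            𝟙[ parityIs a (lth w) ∧ parityIs b (lastCol w) ] * (pow v (lastCol w) * pow q (bck w))
              ≈ 𝟙[ parityIs a n ] * weight b v (lastCol w) (bck w)
    split {w} ≡.refl = trans (*-congʳ (𝟙-∧ (parityIs a n) (parityIs b (lastCol w)))) (*-assoc _ _ _)

  weight-+ : ∀ b v L β γ → weight b v L (β +ℕ γ) ≈ pow q β * weight b v L γ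
  weight-+ b v L β γ = begin
    𝟙[ parityIs b L ] * (pow v L * pow q (β +ℕ γ))        ≈⟨ *-congˡ (*-congˡ (pow-+ q β γ)) ⟩
    𝟙[ parityIs b L ] * (pow v L * (pow q β * pow q γ))
      ≈⟨ solve 4 (λ e V Q Q′ → e :* (V :* (Q :* Q′)) := Q :* (e :* (V :* Q′))) refl _ _ _ _ ⟩
    pow q β * weight b v L γ                              ∎

  -- The weight of a last column of height k + 1 standing at a position of parity a.
  column : ℕ → ℕ → ℕ → Carrier
  column a b k = weight b u (suc k) (blacksInCol a (suc k))

  -- Two more cells, exactly one of them black.
  column-+2 : ∀ a b k → column a b (suc (suc k)) ≈ t * t * column a b k
  column-+2 a b k = begin
    𝟙[ parityIs b (3 +ℕ k) ] * (pow u (3 +ℕ k) * pow q (blacksInCol a (3 +ℕ k)))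
      ≡⟨ ≡.cong₂ (λ p B → 𝟙[ p ] * (pow u (3 +ℕ k) * pow q B))
                 (parityIs-+2 b (suc k)) (blacksInCol-suc-suc a (suc k)) ⟩
    e * (u * (u * U) * (s * s * B))
      ≈⟨ solve 5 (λ s u e U B → e :* (u :* (u :* U) :* (s :* s :* B)) := s :* u :* (s :* u) :* (e :* (U :* B)))
               refl s u e U B ⟩
    t * t * column a b k ∎
    where
    e U B : Carrier
    e = 𝟙[ parityIs b (suc k) ]
    U = pow u (suc k)
    B = pow q (blacksInCol a (suc k))

  ∑-extensions : ∀ a b n w → length w ≡ suc n → parityIs a (suc (suc n)) ≡ true →
    ∑ (map (λ v → weight b u (lastCol v) (bck v)) (map (w ∷ʳ_) (upTo (suc (lastCol w)))))
      ≈ pow q (bck w) * ∑ (map (column a b) (upTo (suc (lastCol w))))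
  ∑-extensions a b n w len j≡a = begin
    ∑ (map (λ v → weight b u (lastCol v) (bck v)) (map (w ∷ʳ_) ks))   ≡⟨ ≡.cong ∑ (map-∘ ks) ⟨
    ∑ (map (λ k → weight b u (lastCol (w ∷ʳ k)) (bck (w ∷ʳ k))) ks)   ≈⟨ ∑-map-cong appended ks ⟩
    ∑ (map (λ k → pow q (bck w) * column a b k) ks)
      ≈⟨ ∑-map-*ˡ (pow q (bck w)) (column a b) ks ⟩
    pow q (bck w) * ∑ (map (column a b) ks)                           ∎
    where
    ks : List ℕ
    ks = upTo (suc (lastCol w))

    appended : ∀ k → weight b u (lastCol (w ∷ʳ k)) (bck (w ∷ʳ k)) ≈ pow q (bck w) * column a b k
    appended k = trans
      (reflexive (≡.cong₂ (λ L β → weight b u (suc L) β) (lastOr-∷ʳ w k) (bck-∷ʳ w k len j≡a)))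
      (weight-+ b u (suc k) (bck w) (blacksInCol a (suc k)))

  LowestColumns : (ℕ → Carrier) → Carrier → Carrier → Set
  LowestColumns g κ A = (g 0 + g 1 ≈ κ) × (g 1 + g 2 ≈ κ * A)

  lowest-even-columns : ∀ a → LowestColumns (column a 0) (u * u * q) 1#
  lowest-even-columns a =
      trans (+-cong (zeroˡ _) height2)
            (solve 2 (λ u q → con 0ℤ :+ con 1ℤ :* (u :* (u :* con 1ℤ) :* (q :* con 1ℤ)) := u :* u :* q) refl u q)
    , trans (+-cong height2 (zeroˡ _))
            (solve 2 (λ u q → con 1ℤ :* (u :* (u :* con 1ℤ) :* (q :* con 1ℤ)) :+ con 0ℤ := u :* u :* q :* con 1ℤ)
                   refl u q)
    where
    height2 : column a 0 1 ≈ 1# * (pow u 2 * pow q 1)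
    height2 = reflexive (≡.cong (λ B → 1# * (pow u 2 * pow q B)) (blacksInCol-suc-suc a 0))

  lowest-odd-columns : ∀ a κ → u * pow q (blacksInCol a 1) ≈ κ → LowestColumns (column a 1) κ (u * u * q)
  lowest-odd-columns a κ uQ≈κ =
      trans (+-congˡ (zeroˡ _))
            (trans (solve 2 (λ u Q → con 1ℤ :* (u :* con 1ℤ :* Q) :+ con 0ℤ := u :* Q) refl u Q) uQ≈κ)
    , trans (+-cong (zeroˡ _) height3)
            (trans (solve 3 (λ u q Q → con 0ℤ :+ con 1ℤ :* (u :* (u :* (u :* con 1ℤ)) :* (q :* Q))
                                     := u :* Q :* (u :* u :* q)) refl u q Q)
                   (*-congʳ uQ≈κ))
    where
    Q : Carrier
    Q = pow q (blacksInCol a 1)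

    height3 : column a 1 2 ≈ 1# * (pow u 3 * (q * Q))
    height3 = reflexive (≡.cong (λ B → 1# * (pow u 3 * pow q B)) (blacksInCol-suc-suc a 1))

  -- combine c A G is c (A G₀(√q u) − G₀(1) + √q u G₁(√q u) − G₁(1)), the shape of every right-hand side.
  combine : Carrier → Carrier → (ℕ → Carrier → Carrier) → Carrier
  combine c A G = c * (A * G 0 t - G 0 1# + t * G 1 t - G 1 1#)

  combine-cong : ∀ c A {G H} → (∀ b v → G b v ≈ H b v) → combine c A G ≈ combine c A H
  combine-cong c A G≈H = *-congˡ (+-cong (+-cong (+-cong (*-congˡ (G≈H 0 t)) (-‿cong (G≈H 0 1#)))
                                                  (*-congˡ (G≈H 1 t)))
                                          (-‿cong (G≈H 1 1#)))

  combine-0# : ∀ c A → combine c A (λ _ _ → 0#) ≈ 0#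
  combine-0# c A = solve 3 (λ c A t → c :* (A :* con 0ℤ :- con 0ℤ :+ t :* con 0ℤ :- con 0ℤ) := con 0ℤ) refl c A t

  combine-+ : ∀ c A G H → combine c A (λ b v → G b v + H b v) ≈ combine c A G + combine c A H
  combine-+ c A G H = solve 11
    (λ c A t x₁ x₂ x₃ x₄ y₁ y₂ y₃ y₄ →
         c :* (A :* (x₁ :+ y₁) :- (x₂ :+ y₂) :+ t :* (x₃ :+ y₃) :- (x₄ :+ y₄))
      := c :* (A :* x₁ :- x₂ :+ t :* x₃ :- x₄) :+ c :* (A :* y₁ :- y₂ :+ t :* y₃ :- y₄))
    refl c A t (G 0 t) (G 0 1#) (G 1 t) (G 1 1#) (H 0 t) (H 0 1#) (H 1 t) (H 1 1#)

  combine-*ˡ : ∀ c A e G → e * combine c A G ≈ combine c A (λ b v → e * G b v)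
  combine-*ˡ c A e G = solve 8
    (λ c A t e x₁ x₂ x₃ x₄ → e :* (c :* (A :* x₁ :- x₂ :+ t :* x₃ :- x₄))
                          := c :* (A :* (e :* x₁) :- e :* x₂ :+ t :* (e :* x₃) :- e :* x₄))
    refl c A t e (G 0 t) (G 0 1#) (G 1 t) (G 1 1#)

  ∑-combine : ∀ {I : Set} c A (f : ℕ → Carrier → I → Carrier) xs →
    combine c A (λ b v → ∑ (map (f b v) xs)) ≈ ∑ (map (λ x → combine c A (λ b v → f b v x)) xs)
  ∑-combine c A f []       = combine-0# c A
  ∑-combine c A f (x ∷ xs) =
    trans (combine-+ c A (λ b v → f b v x) (λ b v → ∑ (map (f b v) xs))) (+-congˡ (∑-combine c A f xs))

  combine-1# : ∀ c G → combine c 1# G ≈ c * (G 0 t - G 0 1# + t * G 1 t - G 1 1#)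
  combine-1# c G = *-congˡ (+-congʳ (+-congʳ (+-congʳ (*-identityˡ (G 0 t)))))

  combine-split : ∀ c A G → combine c A G ≈ 0# + c * (A * G 0 t - G 0 1#) + c * (t * G 1 t - G 1 1#)
  combine-split c A G = solve 7
    (λ c A t x₁ x₂ x₃ x₄ → c :* (A :* x₁ :- x₂ :+ t :* x₃ :- x₄)
                        := con 0ℤ :+ c :* (A :* x₁ :- x₂) :+ c :* (t :* x₃ :- x₄))
    refl c A t (G 0 t) (G 0 1#) (G 1 t) (G 1 1#)

  ≈ₛ-by-cases : ∀ {f g : Series} → f 0 ≈ g 0 → f 1 ≈ g 1 → (∀ n → f (suc (suc n)) ≈ g (suc (suc n))) →
                f ≈ₛ g
  ≈ₛ-by-cases f₀≈g₀ f₁≈g₁ f≈g zero          = f₀≈g₀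
  ≈ₛ-by-cases f₀≈g₀ f₁≈g₁ f≈g (suc zero)    = f₁≈g₁
  ≈ₛ-by-cases f₀≈g₀ f₁≈g₁ f≈g (suc (suc n)) = f≈g n

  module _ (d-inverse : d * (q * (u * u) - 1#) ≈ 1#) where

    ∑-last-column : ∀ (g : ℕ → Carrier) → (∀ k → g (suc (suc k)) ≈ t * t * g k) →
      ∀ κ A → LowestColumns g κ A → ∀ L β →
      pow q β * ∑ (map g (upTo (suc L))) ≈ combine (κ * d) A (λ b v → weight b v L β)
    ∑-last-column g g-rec κ A (g₀₁≈κ , g₁₂≈κA) L β = begin
      Q * S                                                          ≈⟨ *-congˡ (*-identityˡ S) ⟨
      Q * (1# * S)                                                   ≈⟨ *-congˡ (*-congʳ d-inverse′) ⟨
      Q * (d * (t * t - 1#) * S)                                     ≈⟨ *-congˡ (*-assoc d _ S) ⟩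
      Q * (d * ((t * t - 1#) * S))                                   ≈⟨ *-congˡ (*-congˡ telescoped) ⟩
      Q * (d * (e₀ * (κ * A * τ) + e₁ * (κ * (t * τ)) - κ * ((e₀ + e₁) * P)))
        ≈⟨ solve 9 (λ Q d κ A t τ e₀ e₁ P →
                        Q :* (d :* (e₀ :* (κ :* A :* τ) :+ e₁ :* (κ :* (t :* τ)) :- κ :* ((e₀ :+ e₁) :* P)))
                     := κ :* d :* (A :* (e₀ :* (τ :* Q)) :- e₀ :* (P :* Q) :+ t :* (e₁ :* (τ :* Q)) :- e₁ :* (P :* Q)))
                   refl Q d κ A t τ e₀ e₁ P ⟩
      combine (κ * d) A (λ b v → weight b v L β)                     ∎
      where
      S Q τ P e₀ e₁ : Carrier
      S  = ∑ (map g (upTo (suc L)))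
      Q  = pow q β
      τ  = pow t L
      P  = pow 1# L
      e₀ = 𝟙[ parityIs 0 L ]
      e₁ = 𝟙[ parityIs 1 L ]

      d-inverse′ : d * (t * t - 1#) ≈ 1#
      d-inverse′ = trans (*-congˡ (+-congʳ (solve 2 (λ s u → s :* u :* (s :* u) := s :* s :* (u :* u)) refl s u)))
                         d-inverse

      κ≈κ[e₀+e₁]P : κ ≈ κ * ((e₀ + e₁) * P)
      κ≈κ[e₀+e₁]P =
        sym (trans (*-congˡ (trans (*-cong (𝟙-parity L) (pow-1# L)) (*-identityˡ 1#))) (*-identityʳ κ))

      telescoped : (t * t - 1#) * S ≈ e₀ * (κ * A * τ) + e₁ * (κ * (t * τ)) - κ * ((e₀ + e₁) * P)
      telescoped = begin
        (t * t - 1#) * S                                             ≈⟨ ∑-telescope (t * t) g g-rec (suc L) ⟩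
        g (suc L) + g (suc (suc L)) - (g 0 + g 1)
          ≈⟨ +-congʳ (adjacent-terms-by-parity t g g-rec L) ⟩
        e₀ * ((g 1 + g 2) * τ) + e₁ * ((g 0 + g 1) * (t * τ)) - (g 0 + g 1)
          ≈⟨ +-cong (+-cong (*-congˡ (*-congʳ g₁₂≈κA)) (*-congˡ (*-congʳ g₀₁≈κ)))
                    (-‿cong (trans g₀₁≈κ κ≈κ[e₀+e₁]P)) ⟩
        e₀ * (κ * A * τ) + e₁ * (κ * (t * τ)) - κ * ((e₀ + e₁) * P)  ∎

    Φ-recurrence : ∀ a b κ A → LowestColumns (column a b) κ A → ∀ n → parityIs a (suc (suc n)) ≡ true →
      Φ b u (suc (suc n)) ≈ combine (κ * d) A (λ b′ v → Φ b′ v (suc n))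
    Φ-recurrence a b κ A lowest n j≡a = begin
      Φ b u (suc (suc n))
        ≈⟨ ∑-map-concatMap wt extensions ws ⟩
      ∑ (map (λ w → ∑ (map wt (extensions w))) ws)
        ≈⟨ ∑-map-congᴬ (λ {w} len → ∑-extensions a b n w len j≡a) (catalanWords-length (suc n)) ⟩
      ∑ (map (λ w → pow q (bck w) * ∑ (map (column a b) (upTo (suc (lastCol w))))) ws)
        ≈⟨ ∑-map-cong (λ w → ∑-last-column (column a b) (column-+2 a b) κ A lowest (lastCol w) (bck w)) ws ⟩
      ∑ (map (λ w → combine (κ * d) A (λ b′ v → weight b′ v (lastCol w) (bck w))) ws)
        ≈⟨ ∑-combine (κ * d) A (λ b′ v w → weight b′ v (lastCol w) (bck w)) ws ⟨
      combine (κ * d) A (λ b′ v → Φ b′ v (suc n))                       ∎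
      where
      ws : List (List ℕ)
      ws = catalanWords (suc n)

      wt : List ℕ → Carrier
      wt v = weight b u (lastCol v) (bck v)

      extensions : List ℕ → List (List ℕ)
      extensions w = map (w ∷ʳ_) (upTo (suc (lastCol w)))

    F-recurrence : ∀ a a′ b κ A → (∀ n → parityIs a (suc n) ≡ parityIs a′ n) →
      LowestColumns (column a b) κ A →
      ∀ n → F a b u q (suc (suc n)) ≈ combine (κ * d) A (λ b′ v → F a′ b′ v q (suc n))
    F-recurrence a a′ b κ A flip lowest n = begin
      F a b u q (suc (suc n))                                        ≈⟨ F≈𝟙*Φ a b u (suc (suc n)) ⟩
      𝟙[ parityIs a (suc (suc n)) ] * Φ b u (suc (suc n))
        ≈⟨ 𝟙-guard (parityIs a (suc (suc n))) (Φ-recurrence a b κ A lowest n) ⟩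
      𝟙[ parityIs a (suc (suc n)) ] * combine (κ * d) A Φₙ
        ≡⟨ ≡.cong (λ p → 𝟙[ p ] * combine (κ * d) A Φₙ) (flip (suc n)) ⟩
      𝟙[ parityIs a′ (suc n) ] * combine (κ * d) A Φₙ               ≈⟨ combine-*ˡ (κ * d) A _ Φₙ ⟩
      combine (κ * d) A (λ b′ v → 𝟙[ parityIs a′ (suc n) ] * Φₙ b′ v)
        ≈⟨ combine-cong (κ * d) A (λ b′ v → F≈𝟙*Φ a′ b′ v (suc n)) ⟨
      combine (κ * d) A (λ b′ v → F a′ b′ v q (suc n))               ∎
      where
      Φₙ : ℕ → Carrier → Carrier
      Φₙ b′ v = Φ b′ v (suc n)

    F₀₀-equation : F 0 0 u q ≈ₛ X ((u * u * q * d) ⊙ (F 1 0 t q ⊖ F 1 0 1# q ⊕ t ⊙ F 1 1 t q ⊖ F 1 1 1# q))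
    F₀₀-equation = ≈ₛ-by-cases refl (sym (trans (sym (combine-1# _ (λ _ _ → 0#))) (combine-0# _ _)))
      (λ n → trans (F-recurrence 0 1 0 (u * u * q) 1# parityIs-0-suc (lowest-even-columns 0) n)
                 (combine-1# _ (λ b′ v → F 1 b′ v q (suc n))))

    F₁₀-equation : F 1 0 u q ≈ₛ X ((u * u * q * d) ⊙ (F 0 0 t q ⊖ F 0 0 1# q ⊕ t ⊙ F 0 1 t q ⊖ F 0 1 1# q))
    F₁₀-equation = ≈ₛ-by-cases refl (sym (trans (sym (combine-1# _ (λ _ _ → 0#))) (combine-0# _ _)))
      (λ n → trans (F-recurrence 1 0 0 (u * u * q) 1# parityIs-1-suc (lowest-even-columns 1) n)
                 (combine-1# _ (λ b′ v → F 0 b′ v q (suc n))))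

    F₀₁-equation : F 0 1 u q ≈ₛ X ((u * d) ⊙ ((u * u * q) ⊙ F 1 0 t q ⊖ F 1 0 1# q ⊕ t ⊙ F 1 1 t q ⊖ F 1 1 1# q))
    F₀₁-equation = ≈ₛ-by-cases refl (sym (combine-0# _ _))
      (F-recurrence 0 1 1 u (u * u * q) parityIs-0-suc (lowest-odd-columns 0 u (*-identityʳ u)))

    F₁₁-equation : F 1 1 u q ≈ₛ (monoX (u * q) ⊕ X ((u * q * d) ⊙ ((u * u * q) ⊙ F 0 0 t q ⊖ F 0 0 1# q))
                                               ⊕ X ((u * q * d) ⊙ (t ⊙ F 0 1 t q ⊖ F 0 1 1# q)))
    F₁₁-equation = ≈ₛ-by-cases (sym (trans (+-identityʳ _) (+-identityʳ _))) one-cell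
      (λ n → trans (F-recurrence 1 0 1 (u * q) (u * u * q) parityIs-1-suc
                                 (lowest-odd-columns 1 (u * q) (*-congˡ (*-identityʳ q))) n)
                   (combine-split _ _ (λ b′ v → F 0 b′ v q (suc n))))
      where
      one-cell : (u * 1#) * (q * 1#) + 0# ≈ u * q + u * q * d * (u * u * q * 0# - 0#) + u * q * d * (t * 0# - 0#)
      one-cell = solve 5 (λ u q c A t → u :* con 1ℤ :* (q :* con 1ℤ) :+ con 0ℤ
                                      := u :* q :+ c :* (A :* con 0ℤ :- con 0ℤ) :+ c :* (t :* con 0ℤ :- con 0ℤ))
                         refl u q (u * q * d) (u * u * q) t

theorem2p1 : (R : CommutativeRing 0ℓ 0ℓ) →
    let open CommutativeRing R
        open GF R
    in (u s d : Carrier) →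
       let q = s * s
       in d * (q * (u * u) - 1#) ≈ 1# →
          (F 0 0 u q ≈ₛ X ((u * u * q * d) ⊙ (F 1 0 (s * u) q ⊖ F 1 0 1# q ⊕ (s * u) ⊙ F 1 1 (s * u) q ⊖ F 1 1 1# q)))
        × (F 1 0 u q ≈ₛ X ((u * u * q * d) ⊙ (F 0 0 (s * u) q ⊖ F 0 0 1# q ⊕ (s * u) ⊙ F 0 1 (s * u) q ⊖ F 0 1 1# q)))
        × (F 0 1 u q ≈ₛ X ((u * d) ⊙ ((u * u * q) ⊙ F 1 0 (s * u) q ⊖ F 1 0 1# q ⊕ (s * u) ⊙ F 1 1 (s * u) q ⊖ F 1 1 1# q)))
        × (F 1 1 u q ≈ₛ (monoX (u * q) ⊕ X ((u * q * d) ⊙ ((u * u * q) ⊙ F 0 0 (s * u) q ⊖ F 0 0 1# q)) ⊕ X ((u * q * d) ⊙ ((s * u) ⊙ F 0 1 (s * u) q ⊖ F 0 1 1# q))))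
theorem2p1 R u s d d-inverse =
  F₀₀-equation d-inverse , F₁₀-equation d-inverse , F₀₁-equation d-inverse , F₁₁-equation d-inverse
  where open Recurrence R u s d
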